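{- Let $a<b$ be positive odd integers with $\gcd(a,b)=1$ and $a+b\equiv 0\pmod 8$. Then $$r_{(1,1)}(ax^2+by^2,m)=r_{(1,1)}(ax^2+by^2,4m)$$ holds for every integer $m$ divisible by $8$ if and only if $(a,b)\in\{(3,5),(1,7),(1,15)\}$.
   Context: For integers $N$, $r_{(1,1)}(ax^2+by^2,N)$ denotes the number of $(x,y)\in\mathbb Z^2$ with $ax^2+by^2=N$ and both $x,y$ odd. -}

module Defs where

open import Data.Bool using (Bool; _∧_)
open import Data.Nat as ℕ using (ℕ; _%_)
open import Data.Integer as ℤ using (ℤ; +_; _-_; _+_; _*_; ∣_∣)
open import Data.List using (List; map; upTo; concatMap; filter; length)
open import Data.Product using (_×_; _,_)
open import Relation.Nullary.Decidable using (⌊_⌋)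

isOdd : ℤ → Bool
isOdd x = ⌊ (∣ x ∣ % 2) ℕ.≟ 1 ⌋

range : ℕ → List ℤ
range n = map (λ k → + k - + n) (upTo (ℕ.suc (2 ℕ.* n)))

-- Candidate pairs (x , y) with |x|, |y| ≤ |N|.
-- For a, b ≥ 1 every solution of a x² + b y² = N satisfies |x| ≤ x² ≤ N
-- (and likewise for y), so no solution is missed.
candidates : ℤ → List (ℤ × ℤ)
candidates N = concatMap (λ x → map (λ y → (x , y)) (range ∣ N ∣)) (range ∣ N ∣)

isSol11 : ℕ → ℕ → ℤ → ℤ × ℤ → Bool
isSol11 a b N (x , y) =
  isOdd x ∧ isOdd y ∧ ⌊ (+ a * (x * x) + + b * (y * y)) ℤ.≟ N ⌋

-- r₁₁ a b N = r_{(1,1)}(a x² + b y², N) : the number of (x , y) ∈ ℤ²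
-- with a x² + b y² = N and both x and y odd (valid for a, b ≥ 1).
r₁₁ : ℕ → ℕ → ℤ → ℕ
r₁₁ a b N = length (filter (λ p → isSol11 a b N p Data.Bool.≟ Data.Bool.true) (candidates N))

module Submission where

-- Sufficiency.  In each exceptional case c² + ab = 16 (c = 1, 3, 1), so the
-- "twists" (x, y) ↦ (c x ∓ b y, ± a x + c y), i.e. multiplication by
-- c ± √(-ab), multiply the form by 16 (Brahmagupta's identity), and two
-- conjugate twists compose to 16.  Halving a suitable twist of an odd solution
-- at N gives an odd solution at 4N, and dividing a suitable twist of that by 8
-- returns.  Which twist is suitable depends only on residues modulo 32, so
-- the choice is made by Boolean congruence tests; that the choices are always
-- consistent is a statement about (ℤ/32)², verified by evaluation.  The two
-- mutually inverse maps then equate the numbers of solutions.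
--
-- Necessity.  The identity transports odd representations n = a X² + b Y²
-- with 8 ∣ n to 4n.  Lifting a + b = a·1² + b·1² forces a X² = 4a + 3b, hence
-- a ∣ 3.  Lifting 9 + b = 1·3² + b·1² (a = 1), resp. 3 + 9b = 3·1² + b·3²
-- (a = 3), leaves only b ∈ {7, 15}, resp. b = 5, since two squares differing
-- by 32 have smaller root at most 7.

open import Defs

module ResidueTests where

  open import Data.Bool using (Bool; true; false; T; _∧_; _∨_; not)
  open import Data.Nat as ℕ using (ℕ)
  open import Data.Integer as ℤ using (ℤ; +_; _+_; _*_; ∣_∣)
  import Data.Integer.DivMod as ℤ
  open import Data.Integer.Divisibility.Signed using (_∣_; divides; ∣ᵤ⇒∣; ∣⇒∣ᵤ; ∣m+n∣n⇒∣m; ∣m∣n⇒∣m+n)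
  import Data.Nat.Divisibility as ℕ
  import Data.Nat.Properties as ℕ
  open import Data.Integer.Tactic.RingSolver using (solve-∀)
  open import Data.List using (upTo)
  open import Data.Bool.ListAction using (all)
  open import Data.List.Membership.Propositional.Properties using (∈-upTo⁺)
  open import Data.List.Relation.Unary.All as All using ()
  open import Data.List.Relation.Unary.All.Properties using (all⁺)
  open import Data.Product using (_×_; _,_)
  open import Data.Empty using (⊥-elim)
  open import Function.Bundles using (_⇔_; mk⇔; Equivalence)
  import Function.Properties.Equivalence as ⇔
  open import Relation.Binary.PropositionalEquality

  Point : Set
  Point = ℤ × ℤ

  T-⇔⇒≡ : ∀ x y → (T x ⇔ T y) → x ≡ y
  T-⇔⇒≡ true  true  _     = refl
  T-⇔⇒≡ true  false x⇔y = ⊥-elim (Equivalence.to x⇔y _)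
  T-⇔⇒≡ false true  x⇔y = ⊥-elim (Equivalence.from x⇔y _)
  T-⇔⇒≡ false false _     = refl

  div32 : ℤ → Bool
  div32 z = (∣ z ∣ ℕ.% 32) ℕ.≡ᵇ 0

  div32-correct : ∀ z → T (div32 z) ⇔ (+ 32 ∣ z)
  div32-correct z = mk⇔
    (λ t → ∣ᵤ⇒∣ (ℕ.m%n≡0⇒n∣m ∣ z ∣ 32 (ℕ.≡ᵇ⇒≡ _ 0 t)))
    (λ d → ℕ.≡⇒≡ᵇ _ 0 (ℕ.n∣m⇒m%n≡0 ∣ z ∣ 32 (∣⇒∣ᵤ d)))

  div32-shift : ∀ z w → div32 (z + w * + 32) ≡ div32 z
  div32-shift z w = T-⇔⇒≡ (div32 (z + w * + 32)) (div32 z)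
    (⇔.trans (div32-correct _) (⇔.trans shift (⇔.sym (div32-correct z))))
    where
      32∣w*32 : + 32 ∣ w * + 32
      32∣w*32 = divides w refl

      shift : (+ 32 ∣ z + w * + 32) ⇔ (+ 32 ∣ z)
      shift = mk⇔ (λ d → ∣m+n∣n⇒∣m d 32∣w*32) (λ d → ∣m∣n⇒∣m+n d 32∣w*32)

  infixr 6 _∧ᵗ_
  infixr 5 _∨ᵗ_
  data Test : Set where
    linear    : (α β γ : ℤ) → Test
    quadratic : (α β : ℤ) → Test
    ⊤ᵗ        : Test
    ¬ᵗ_       : Test → Test
    _∧ᵗ_ _∨ᵗ_ : Test → Test → Test

  ⟦_⟧ : Test → Point → Bool
  ⟦ linear α β γ ⟧  (x , y) = div32 (α * x + β * y + γ)
  ⟦ quadratic α β ⟧ (x , y) = div32 (α * (x * x) + β * (y * y))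
  ⟦ ⊤ᵗ ⟧            p       = true
  ⟦ ¬ᵗ t ⟧          p       = not (⟦ t ⟧ p)
  ⟦ t ∧ᵗ u ⟧        p       = ⟦ t ⟧ p ∧ ⟦ u ⟧ p
  ⟦ t ∨ᵗ u ⟧        p       = ⟦ t ⟧ p ∨ ⟦ u ⟧ p

  linear-shift : ∀ α β γ x y q s →
    α * (x + q * + 32) + β * (y + s * + 32) + γ ≡ (α * x + β * y + γ) + (α * q + β * s) * + 32
  linear-shift = solve-∀

  quadratic-shift : ∀ α β x y q s →
    α * ((x + q * + 32) * (x + q * + 32)) + β * ((y + s * + 32) * (y + s * + 32))
      ≡ (α * (x * x) + β * (y * y))
        + (α * (+ 2 * x * q + q * q * + 32) + β * (+ 2 * y * s + s * s * + 32)) * + 32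
  quadratic-shift = solve-∀

  ⟦⟧-periodic : ∀ t x y q s → ⟦ t ⟧ (x + q * + 32 , y + s * + 32) ≡ ⟦ t ⟧ (x , y)
  ⟦⟧-periodic (linear α β γ) x y q s =
    trans (cong div32 (linear-shift α β γ x y q s)) (div32-shift (α * x + β * y + γ) (α * q + β * s))
  ⟦⟧-periodic (quadratic α β) x y q s =
    trans (cong div32 (quadratic-shift α β x y q s))
          (div32-shift (α * (x * x) + β * (y * y)) (α * (+ 2 * x * q + q * q * + 32) + β * (+ 2 * y * s + s * s * + 32)))
  ⟦⟧-periodic ⊤ᵗ        x y q s = refl
  ⟦⟧-periodic (¬ᵗ t)    x y q s = cong not (⟦⟧-periodic t x y q s)
  ⟦⟧-periodic (t ∧ᵗ u)  x y q s = cong₂ _∧_ (⟦⟧-periodic t x y q s) (⟦⟧-periodic u x y q s)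
  ⟦⟧-periodic (t ∨ᵗ u)  x y q s = cong₂ _∨_ (⟦⟧-periodic t x y q s) (⟦⟧-periodic u x y q s)

  holdsOnResidues : Test → Bool
  holdsOnResidues t = all (λ i → all (λ j → ⟦ t ⟧ (+ i , + j)) (upTo 32)) (upTo 32)

  holdsEverywhere : ∀ t → T (holdsOnResidues t) → ∀ p → T (⟦ t ⟧ p)
  holdsEverywhere t check (x , y) = subst T (sym shifted) atResidue
    where
      i j : ℕ
      i = x ℤ.% + 32
      j = y ℤ.% + 32

      column : ℕ → Point
      column r = (+ i , + r)

      row : ℕ → Bool
      row r = all (λ s → ⟦ t ⟧ (+ r , + s)) (upTo 32)

      rowAtResidue : T (row i)
      rowAtResidue = All.lookup (all⁺ row (upTo 32) check) (∈-upTo⁺ (ℤ.n%d<d x (+ 32)))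

      atResidue : T (⟦ t ⟧ (+ i , + j))
      atResidue = All.lookup (all⁺ (λ s → ⟦ t ⟧ (column s)) (upTo 32) rowAtResidue) (∈-upTo⁺ (ℤ.n%d<d y (+ 32)))

      shifted : ⟦ t ⟧ (x , y) ≡ ⟦ t ⟧ (+ i , + j)
      shifted = trans (cong₂ (λ u v → ⟦ t ⟧ (u , v)) (ℤ.a≡a%n+[a/n]*n x (+ 32)) (ℤ.a≡a%n+[a/n]*n y (+ 32)))
                      (⟦⟧-periodic t (+ i) (+ j) (x ℤ./ + 32) (y ℤ./ + 32))

module Points where

  open ResidueTests

  open import Data.Bool using (Bool; T)
  open import Data.Bool.Properties using (T-∧)
  open import Data.Nat as ℕ using (ℕ; suc)
  import Data.Nat.DivMod as ℕ
  open import Data.Integer using (ℤ; +_; -[1+_]; _+_; _*_; -_; _-_)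
  import Data.Integer.Properties as ℤP
  open import Data.Integer.Divisibility.Signed using (_∣_; divides)
  open import Data.Integer.Tactic.RingSolver using (solve-∀)
  open import Data.Product using (∃-syntax; _×_; _,_; proj₁; proj₂)
  open import Function.Bundles using (Equivalence)
  open import Relation.Binary.PropositionalEquality

  open Equivalence using (to; from)

  Odd : ℤ → Set
  Odd x = ∃[ m ] x ≡ m * + 2 + + 1

  OddPair : Point → Set
  OddPair (x , y) = Odd x × Odd y

  form : ℕ → ℕ → Point → ℤ
  form a b (x , y) = + a * (x * x) + + b * (y * y)

  infixl 7 _÷_ _÷ₚ_
  _÷_ : ℤ → (k : ℕ) → .{{ℕ.NonZero k}} → ℤ
  + n      ÷ k = + (n ℕ./ k)
  -[1+ n ] ÷ k = - + (suc n ℕ./ k)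

  ÷-exact : ∀ k .{{_ : ℕ.NonZero k}} q → + k * q ÷ k ≡ q
  ÷-exact k q = trans (cong (_÷ k) (ℤP.*-comm (+ k) q)) (exact q k)
    where
      exact : ∀ q k .{{_ : ℕ.NonZero k}} → q * + k ÷ k ≡ q
      exact (+ n)      k       = trans (cong (_÷ k) (sym (ℤP.pos-* n k))) (cong +_ (ℕ.m*n/n≡m n k))
      exact -[1+ n ]   (suc d) = cong (λ t → - + t) (ℕ.m*n/n≡m (suc n) (suc d))

  infixr 7 _⊙_
  _⊙_ : ℤ → Point → Point
  k ⊙ (x , y) = (k * x , k * y)

  _÷ₚ_ : Point → (k : ℕ) → .{{ℕ.NonZero k}} → Point
  (x , y) ÷ₚ k = (x ÷ k , y ÷ k)

  ÷ₚ-exact : ∀ k .{{_ : ℕ.NonZero k}} w → (+ k ⊙ w) ÷ₚ k ≡ w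
  ÷ₚ-exact k (x , y) = cong₂ _,_ (÷-exact k x) (÷-exact k y)

  ⊙-cancel : ∀ k .{{_ : ℕ.NonZero k}} v w → + k ⊙ v ≡ + k ⊙ w → v ≡ w
  ⊙-cancel k v w eq = trans (sym (÷ₚ-exact k v)) (trans (cong (_÷ₚ k) eq) (÷ₚ-exact k w))

  ⊙-assoc : ∀ k l w → k ⊙ (l ⊙ w) ≡ (k * l) ⊙ w
  ⊙-assoc k l (x , y) = cong₂ _,_ (sym (ℤP.*-assoc k l x)) (sym (ℤP.*-assoc k l y))

  record Matrix : Set where
    constructor matrix
    field m₁₁ m₁₂ m₂₁ m₂₂ : ℤ

  infixr 5 _$_
  _$_ : Matrix → Point → Point
  matrix p q r s $ (x , y) = (p * x + q * y , r * x + s * y)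

  _·_ : Matrix → Matrix → Matrix
  matrix p q r s · matrix p′ q′ r′ s′ =
    matrix (p * p′ + q * r′) (p * q′ + q * s′) (r * p′ + s * r′) (r * q′ + s * s′)

  ·-$ : ∀ M N w → (M · N) $ w ≡ M $ (N $ w)
  ·-$ (matrix p q r s) (matrix p′ q′ r′ s′) (x , y) =
    cong₂ _,_ (ring p q p′ q′ r′ s′ x y) (ring r s p′ q′ r′ s′ x y)
    where
      ring : ∀ p q p′ q′ r′ s′ x y → (p * p′ + q * r′) * x + (p * q′ + q * s′) * y
                                     ≡ p * (p′ * x + q′ * y) + q * (r′ * x + s′ * y)
      ring = solve-∀

  $-⊙ : ∀ M k w → M $ (k ⊙ w) ≡ k ⊙ (M $ w)
  $-⊙ (matrix p q r s) k (x , y) = cong₂ _,_ (ring p q k x y) (ring r s k x y)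
    where
      ring : ∀ p q k x y → p * (k * x) + q * (k * y) ≡ k * (p * x + q * y)
      ring = solve-∀

  form-⊙ : ∀ a b k w → form a b (k ⊙ w) ≡ (k * k) * form a b w
  form-⊙ a b k (x , y) = ring (+ a) (+ b) k x y
    where
      ring : ∀ A B k x y → A * ((k * x) * (k * x)) + B * ((k * y) * (k * y)) ≡ (k * k) * (A * (x * x) + B * (y * y))
      ring = solve-∀

  identity : Matrix
  identity = matrix (+ 1) (+ 0) (+ 0) (+ 1)

  -- The test "M p = k · w for an odd pair w", where e k = 16: every coordinate z
  -- of M p satisfies 32 ∣ e z - 16.
  oddMultiple : ℤ → Matrix → Test
  oddMultiple e (matrix p q r s) = linear (e * p) (e * q) (- + 16) ∧ᵗ linear (e * r) (e * s) (- + 16)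

  module _ (e k : ℕ) .{{_ : ℕ.NonZero e}} (ek≡16 : + e * + k ≡ + 16) where

    private
      regroup : ∀ e p q x y → (e * p) * x + (e * q) * y + - + 16 ≡ e * (p * x + q * y) - + 16
      regroup = solve-∀

      scaled-odd : ∀ m → + e * (+ k * (m * + 2 + + 1)) - + 16 ≡ m * + 32
      scaled-odd m = begin
        + e * (+ k * (m * + 2 + + 1)) - + 16 ≡⟨ cong (_- + 16) (sym (ℤP.*-assoc (+ e) (+ k) _)) ⟩
        + e * + k * (m * + 2 + + 1) - + 16   ≡⟨ cong (λ t → t * (m * + 2 + + 1) - + 16) ek≡16 ⟩
        + 16 * (m * + 2 + + 1) - + 16        ≡⟨ ring m ⟩
        m * + 32                             ∎
        where
          open ≡-Reasoning
          ring : ∀ m → + 16 * (m * + 2 + + 1) - + 16 ≡ m * + 32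
          ring = solve-∀

      minus16-injective : ∀ s t → s - + 16 ≡ t - + 16 → s ≡ t
      minus16-injective s t eq = trans (sym (ring s)) (trans (cong (_+ + 16) eq) (ring t))
        where
          ring : ∀ s → s - + 16 + + 16 ≡ s
          ring = solve-∀

      coordinate-sound : ∀ z → + 32 ∣ + e * z - + 16 → ∃[ w ] Odd w × z ≡ + k * w
      coordinate-sound z (divides m eq) = (m * + 2 + + 1) , (m , refl) ,
        ℤP.*-cancelˡ-≡ (+ e) z _ (minus16-injective _ _ (trans eq (sym (scaled-odd m))))

      coordinate-complete : ∀ w → Odd w → + 32 ∣ + e * (+ k * w) - + 16
      coordinate-complete w (m , refl) = divides m (scaled-odd m)

      coordinate-test : ℤ → ℤ → Point → Bool
      coordinate-test p q (x , y) = div32 ((+ e * p) * x + (+ e * q) * y + - + 16)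

      coordinate-test-sound : ∀ p q x y → T (coordinate-test p q (x , y)) → ∃[ w ] Odd w × p * x + q * y ≡ + k * w
      coordinate-test-sound p q x y holds =
        coordinate-sound (p * x + q * y) (to (div32-correct (+ e * (p * x + q * y) - + 16)) (subst T (cong div32 (regroup (+ e) p q x y)) holds))

      coordinate-test-complete : ∀ p q x y w → Odd w → p * x + q * y ≡ + k * w → T (coordinate-test p q (x , y))
      coordinate-test-complete p q x y w odd eq = subst T (cong div32 (sym (regroup (+ e) p q x y)))
        (from (div32-correct (+ e * (p * x + q * y) - + 16)) (subst (λ z → + 32 ∣ + e * z - + 16) (sym eq) (coordinate-complete w odd)))

    oddMultiple-complete : ∀ M p w → OddPair w → M $ p ≡ + k ⊙ w → T (⟦ oddMultiple (+ e) M ⟧ p)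
    oddMultiple-complete (matrix p q r s) (x , y) (w₁ , w₂) (odd₁ , odd₂) eq =
      from (T-∧ {coordinate-test p q (x , y)} {coordinate-test r s (x , y)})
        (coordinate-test-complete p q x y w₁ odd₁ (cong proj₁ eq) , coordinate-test-complete r s x y w₂ odd₂ (cong proj₂ eq))

    oddMultiple-sound : ∀ M p → T (⟦ oddMultiple (+ e) M ⟧ p) → ∃[ w ] OddPair w × M $ p ≡ + k ⊙ w
    oddMultiple-sound (matrix p q r s) (x , y) holds =
      pair (coordinate-test-sound p q x y (proj₁ tests)) (coordinate-test-sound r s x y (proj₂ tests))
      where
        tests : T (coordinate-test p q (x , y)) × T (coordinate-test r s (x , y))
        tests = to (T-∧ {coordinate-test p q (x , y)} {coordinate-test r s (x , y)}) holds

        pair : ∃[ w₁ ] Odd w₁ × p * x + q * y ≡ + k * w₁ → ∃[ w₂ ] Odd w₂ × r * x + s * y ≡ + k * w₂ →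
               ∃[ w ] OddPair w × matrix p q r s $ (x , y) ≡ + k ⊙ w
        pair (w₁ , odd₁ , eq₁) (w₂ , odd₂ , eq₂) = (w₁ , w₂) , (odd₁ , odd₂) , cong₂ _,_ eq₁ eq₂

module Composition where

  open ResidueTests
  open Points

  open import Data.Bool using (Bool; true; false; T; not; _∧_; _∨_; if_then_else_)
  open import Data.Bool.Properties using (T?)
  open import Data.Empty using (⊥-elim)
  open import Data.Nat as ℕ using (ℕ)
  open import Data.Integer using (ℤ; +_; _+_; _*_; -_)
  import Data.Integer.Properties as ℤP
  open import Data.Integer.Tactic.RingSolver using (solve-∀)
  open import Data.Product using (_×_; _,_; proj₁; proj₂)
  open import Data.Unit using (tt)
  open import Relation.Binary.PropositionalEquality
  open import Relation.Nullary using (¬_; yes; no)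

  module Twists (a b : ℕ) (c : ℤ) (c²+ab≡16 : c * c + + a * + b ≡ + 16) where

    -- Multiplication by c ± √(-ab) in the coordinates of a x² + b y².
    twist : Bool → Matrix
    twist true  = matrix c (- + b) (+ a) c
    twist false = matrix c (+ b) (- + a) c

    twist-form : ∀ σ w → form a b (twist σ $ w) ≡ + 16 * form a b w
    twist-form σ w = trans (brahmagupta σ w) (cong (_* form a b w) c²+ab≡16)
      where
        ring⁺ : ∀ A B c x y → A * ((c * x + - B * y) * (c * x + - B * y)) + B * ((A * x + c * y) * (A * x + c * y))
                              ≡ (c * c + A * B) * (A * (x * x) + B * (y * y))
        ring⁺ = solve-∀
        ring⁻ : ∀ A B c x y → A * ((c * x + B * y) * (c * x + B * y)) + B * ((- A * x + c * y) * (- A * x + c * y))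
                              ≡ (c * c + A * B) * (A * (x * x) + B * (y * y))
        ring⁻ = solve-∀

        brahmagupta : ∀ σ w → form a b (twist σ $ w) ≡ (c * c + + a * + b) * form a b w
        brahmagupta true  (x , y) = ring⁺ (+ a) (+ b) c x y
        brahmagupta false (x , y) = ring⁻ (+ a) (+ b) c x y

    twist-conjugate : ∀ σ w → twist (not σ) $ twist σ $ w ≡ + 16 ⊙ w
    twist-conjugate σ w = trans (product σ w) (cong (_⊙ w) c²+ab≡16)
      where
        ring₁ : ∀ A B c x y → c * (c * x + - B * y) + B * (A * x + c * y) ≡ (c * c + A * B) * x
        ring₁ = solve-∀
        ring₂ : ∀ A B c x y → - A * (c * x + - B * y) + c * (A * x + c * y) ≡ (c * c + A * B) * y
        ring₂ = solve-∀
        ring₃ : ∀ A B c x y → c * (c * x + B * y) + - B * (- A * x + c * y) ≡ (c * c + A * B) * x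
        ring₃ = solve-∀
        ring₄ : ∀ A B c x y → A * (c * x + B * y) + c * (- A * x + c * y) ≡ (c * c + A * B) * y
        ring₄ = solve-∀

        product : ∀ σ w → twist (not σ) $ twist σ $ w ≡ (c * c + + a * + b) ⊙ w
        product true  (x , y) = cong₂ _,_ (ring₁ (+ a) (+ b) c x y) (ring₂ (+ a) (+ b) c x y)
        product false (x , y) = cong₂ _,_ (ring₃ (+ a) (+ b) c x y) (ring₄ (+ a) (+ b) c x y)

    descend : ∀ e k .{{_ : ℕ.NonZero k}} → + e * + k ≡ + 16 → ∀ σ w u → twist σ $ w ≡ + k ⊙ u →
              (+ k * + k) * form a b u ≡ + 16 * form a b w × twist (not σ) $ u ≡ + e ⊙ w
    descend e k ek≡16 σ w u σw≡ku = value , back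
      where
        open ≡-Reasoning
        value : (+ k * + k) * form a b u ≡ + 16 * form a b w
        value = begin
          (+ k * + k) * form a b u  ≡⟨ form-⊙ a b (+ k) u ⟨
          form a b (+ k ⊙ u)        ≡⟨ cong (form a b) σw≡ku ⟨
          form a b (twist σ $ w)    ≡⟨ twist-form σ w ⟩
          + 16 * form a b w         ∎
        back : twist (not σ) $ u ≡ + e ⊙ w
        back = ⊙-cancel k _ _ (begin
          + k ⊙ (twist (not σ) $ u)       ≡⟨ $-⊙ (twist (not σ)) (+ k) u ⟨
          twist (not σ) $ (+ k ⊙ u)       ≡⟨ cong (twist (not σ) $_) σw≡ku ⟨
          twist (not σ) $ twist σ $ w     ≡⟨ twist-conjugate σ w ⟩
          + 16 ⊙ w                        ≡⟨ cong (_⊙ w) (trans (sym ek≡16) (ℤP.*-comm (+ e) (+ k))) ⟩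
          (+ k * + e) ⊙ w                 ≡⟨ ⊙-assoc (+ k) (+ e) w ⟨
          + k ⊙ (+ e ⊙ w)                 ∎)

    choice : ℤ → Bool → Point → Bool
    choice e σ₀ w = if ⟦ oddMultiple e (twist σ₀) ⟧ w then σ₀ else not σ₀

    step : ℕ → (k : ℕ) → .{{ℕ.NonZero k}} → Bool → Point → Point
    step e k σ₀ w = (twist (choice (+ e) σ₀ w) $ w) ÷ₚ k

    -- The residue condition making `step e k σ₀` invertible on odd points
    -- satisfying `hyp`: the preferred twist yields k · (odd pair), or else the
    -- conjugate twist τ does while τ² does not yield 16 · (odd pair).
    admissible : Test → ℤ → Bool → Test
    admissible hyp e σ₀ =
      ¬ᵗ (oddMultiple (+ 16) identity ∧ᵗ hyp) ∨ᵗ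
        (oddMultiple e (twist σ₀) ∨ᵗ
          (oddMultiple e (twist (not σ₀)) ∧ᵗ ¬ᵗ oddMultiple (+ 1) (twist (not σ₀) · twist (not σ₀))))

    module RoundTrip (e k : ℕ) .{{_ : ℕ.NonZero e}} .{{_ : ℕ.NonZero k}} (ek≡16 : + e * + k ≡ + 16)
                     (hyp : Test) (σ₀ : Bool) (adm : ∀ w → T (⟦ admissible hyp (+ e) σ₀ ⟧ w)) where

      private
        ke≡16 : + k * + e ≡ + 16
        ke≡16 = trans (ℤP.*-comm (+ k) (+ e)) ek≡16

        τ₀ : Matrix
        τ₀ = twist (not σ₀)

        if-true : ∀ {A : Set} b {x y : A} → T b → (if b then x else y) ≡ x
        if-true true _ = refl

        if-false : ∀ {A : Set} b {x y : A} → ¬ T b → (if b then x else y) ≡ y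
        if-false true  ¬b = ⊥-elim (¬b tt)
        if-false false _  = refl

        admissible-cases : ∀ o h A B C → T o → T h → T (not (o ∧ h) ∨ (A ∨ (B ∧ not C))) →
                           ¬ T A → T B × ¬ T C
        admissible-cases true true true  _     _     _ _ _  ¬A = ⊥-elim (¬A tt)
        admissible-cases true true false true  false _ _ _  _  = tt , λ ()
        admissible-cases true true false true  true  _ _ () _
        admissible-cases true true false false _     _ _ () _

        odd-test : ∀ w → OddPair w → T (⟦ oddMultiple (+ 16) identity ⟧ w)
        odd-test (x , y) odd = oddMultiple-complete 16 1 refl identity (x , y) (x , y) odd
          (cong₂ _,_ (ring₁ x y) (ring₂ x y))
          where
            ring₁ : ∀ x y → + 1 * x + + 0 * y ≡ + 1 * x
            ring₁ = solve-∀
            ring₂ : ∀ x y → + 0 * x + + 1 * y ≡ + 1 * y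
            ring₂ = solve-∀

      record Selection (w : Point) : Set where
        field
          τ       : Bool
          chosen  : choice (+ e) σ₀ w ≡ τ
          u       : Point
          u-odd   : OddPair u
          τw≡ku   : twist τ $ w ≡ + k ⊙ u
          returns : choice (+ k) (not σ₀) u ≡ not τ

      -- The preferred twist yields an odd quotient u; the conjugate twist
      -- brings u back to e · w, so the reverse step selects it.
      preferred-selection : ∀ w → OddPair w → T (⟦ oddMultiple (+ e) (twist σ₀) ⟧ w) →
                            ∀ u → OddPair u → twist σ₀ $ w ≡ + k ⊙ u → Selection w
      preferred-selection w w-odd preferred u u-odd σ₀w≡ku = record
        { τ = σ₀ ; chosen = if-true _ preferred ; u = u ; u-odd = u-odd ; τw≡ku = σ₀w≡ku
        ; returns = if-true _ (oddMultiple-complete k e ke≡16 τ₀ u w w-odd (proj₂ (descend e k ek≡16 σ₀ w u σ₀w≡ku))) }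

      -- Otherwise the conjugate twist τ₀ yields an odd quotient u.  If τ₀ u were
      -- e · v for an odd pair v, then τ₀² w = 16 v, which admissibility excludes;
      -- so the reverse step selects σ₀.
      conjugate-selection : ∀ w → ¬ T (⟦ oddMultiple (+ e) (twist σ₀) ⟧ w) →
                            ¬ T (⟦ oddMultiple (+ 1) (τ₀ · τ₀) ⟧ w) →
                            ∀ u → OddPair u → τ₀ $ w ≡ + k ⊙ u → Selection w
      conjugate-selection w ¬preferred ¬τ₀² u u-odd τ₀w≡ku = record
        { τ = not σ₀ ; chosen = if-false _ ¬preferred ; u = u ; u-odd = u-odd ; τw≡ku = τ₀w≡ku
        ; returns = if-false _ τ₀-fails }
        where
          τ₀-fails : ¬ T (⟦ oddMultiple (+ k) τ₀ ⟧ u)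
          τ₀-fails holds =
            let (v , v-odd , τ₀u≡ev) = oddMultiple-sound k e ke≡16 τ₀ u holds
            in ¬τ₀² (oddMultiple-complete 1 16 refl (τ₀ · τ₀) w v v-odd (begin
              (τ₀ · τ₀) $ w      ≡⟨ ·-$ τ₀ τ₀ w ⟩
              τ₀ $ τ₀ $ w        ≡⟨ cong (τ₀ $_) τ₀w≡ku ⟩
              τ₀ $ (+ k ⊙ u)     ≡⟨ $-⊙ τ₀ (+ k) u ⟩
              + k ⊙ (τ₀ $ u)     ≡⟨ cong (+ k ⊙_) τ₀u≡ev ⟩
              + k ⊙ (+ e ⊙ v)    ≡⟨ ⊙-assoc (+ k) (+ e) v ⟩
              (+ k * + e) ⊙ v    ≡⟨ cong (_⊙ v) ke≡16 ⟩
              + 16 ⊙ v           ∎))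
            where open ≡-Reasoning

      select : ∀ w → OddPair w → T (⟦ hyp ⟧ w) → Selection w
      select w w-odd hyp-w with T? (⟦ oddMultiple (+ e) (twist σ₀) ⟧ w)
      ... | yes preferred =
        let (u , u-odd , σ₀w≡ku) = oddMultiple-sound e k ek≡16 (twist σ₀) w preferred
        in preferred-selection w w-odd preferred u u-odd σ₀w≡ku
      ... | no ¬preferred =
        let (τ₀-odd , ¬τ₀²) = admissible-cases
              (⟦ oddMultiple (+ 16) identity ⟧ w) (⟦ hyp ⟧ w) (⟦ oddMultiple (+ e) (twist σ₀) ⟧ w)
              (⟦ oddMultiple (+ e) τ₀ ⟧ w) (⟦ oddMultiple (+ 1) (τ₀ · τ₀) ⟧ w)
              (odd-test w w-odd) hyp-w (adm w) ¬preferred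
            (u , u-odd , τ₀w≡ku) = oddMultiple-sound e k ek≡16 τ₀ w τ₀-odd
        in conjugate-selection w ¬preferred ¬τ₀² u u-odd τ₀w≡ku

      round-trip : ∀ w → OddPair w → T (⟦ hyp ⟧ w) →
                   OddPair (step e k σ₀ w)
                   × (+ k * + k) * form a b (step e k σ₀ w) ≡ + 16 * form a b w
                   × step k e (not σ₀) (step e k σ₀ w) ≡ w
      round-trip w w-odd hyp-w = subst Goal (sym step≡u) (u-odd , value , back)
        where
          open Selection (select w w-odd hyp-w)
          open ≡-Reasoning

          Goal : Point → Set
          Goal u′ = OddPair u′ × (+ k * + k) * form a b u′ ≡ + 16 * form a b w × step k e (not σ₀) u′ ≡ w

          step≡u : step e k σ₀ w ≡ u
          step≡u = begin
            (twist (choice (+ e) σ₀ w) $ w) ÷ₚ k  ≡⟨ cong (λ σ → (twist σ $ w) ÷ₚ k) chosen ⟩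
            (twist τ $ w) ÷ₚ k                    ≡⟨ cong (_÷ₚ k) τw≡ku ⟩
            (+ k ⊙ u) ÷ₚ k                        ≡⟨ ÷ₚ-exact k u ⟩
            u                                     ∎

          value : (+ k * + k) * form a b u ≡ + 16 * form a b w
          value = proj₁ (descend e k ek≡16 τ w u τw≡ku)

          back : step k e (not σ₀) u ≡ w
          back = begin
            (twist (choice (+ k) (not σ₀) u) $ u) ÷ₚ e  ≡⟨ cong (λ σ → (twist σ $ u) ÷ₚ e) returns ⟩
            (twist (not τ) $ u) ÷ₚ e                    ≡⟨ cong (_÷ₚ e) (proj₂ (descend e k ek≡16 τ w u τw≡ku)) ⟩
            (+ e ⊙ w) ÷ₚ e                              ≡⟨ ÷ₚ-exact e w ⟩
            w                                           ∎

module Counting where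

  open ResidueTests using (Point)
  open Points using (Odd; OddPair; form)

  open import Data.Bool using (Bool; true; T)
  import Data.Bool as Bool
  open import Data.Bool.Properties using (T-≡; T-∧)
  open import Data.Nat as ℕ using (ℕ; zero; suc; _≤_; _<_; z≤n; s≤s)
  import Data.Nat.Properties as ℕP
  import Data.Nat.DivMod as ℕ
  import Data.Nat.Divisibility as ℕ
  open import Data.Integer as ℤ using (ℤ; +_; -[1+_]; _+_; _*_; -_; _-_; ∣_∣)
  import Data.Integer.Properties as ℤP
  import Data.Integer.DivMod as ℤ
  open import Data.Integer.Divisibility.Signed using (divides; ∣ᵤ⇒∣)
  open import Data.Integer.Tactic.RingSolver using (solve-∀)
  open import Data.List using (List; []; _∷_; map; concatMap; filter; length; cartesianProduct; _++_)
  import Data.List.Properties as List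
  open import Data.List.Membership.Propositional using (_∈_)
  open import Data.List.Membership.Propositional.Properties
    using (∈-upTo⁺; ∈-map⁺; ∈-map⁻; ∈-filter⁺; ∈-filter⁻; ∈-cartesianProduct⁺)
  open import Data.List.Membership.Propositional.Properties.WithK using (unique∧set⇒bag)
  open import Data.List.Relation.Binary.BagAndSetEquality using (∼bag⇒↭)
  open import Data.List.Relation.Binary.Permutation.Propositional.Properties using (↭-length)
  open import Data.List.Relation.Unary.Any using (here; there)
  import Data.List.Relation.Unary.All as All
  open import Data.List.Relation.Unary.Unique.Propositional using (Unique)
  import Data.List.Relation.Unary.Unique.Propositional.Properties as Unique
  open import Data.Product using (∃-syntax; _×_; _,_; proj₂)
  open import Data.Sum using (_⊎_; inj₁; inj₂)
  open import Data.Empty using (⊥-elim)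
  open import Function.Bundles using (_⇔_; mk⇔; Equivalence)
  open import Relation.Binary.PropositionalEquality
  open import Relation.Nullary.Decidable using (⌊_⌋; toWitness; fromWitness)

  open Equivalence using (to; from)

  length-bijection : ∀ {A B : Set} {xs : List A} {ys : List B} → Unique xs → Unique ys →
    (f : A → B) (g : B → A) →
    (∀ {x} → x ∈ xs → f x ∈ ys) → (∀ {y} → y ∈ ys → g y ∈ xs) →
    (∀ {x} → x ∈ xs → g (f x) ≡ x) → (∀ {y} → y ∈ ys → f (g y) ≡ y) →
    length xs ≡ length ys
  length-bijection {xs = xs} {ys} xs! ys! f g f∈ g∈ gf fg =
    trans (sym (List.length-map f xs)) (↭-length (∼bag⇒↭ (unique∧set⇒bag fxs! ys! (mk⇔ to-ys from-ys))))
    where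
      gfxs≡xs : map g (map f xs) ≡ xs
      gfxs≡xs = trans (sym (List.map-∘ xs)) (List.map-id-local (All.tabulate gf))

      fxs! : Unique (map f xs)
      fxs! = Unique.map⁻ (subst Unique (sym gfxs≡xs) xs!)

      to-ys : ∀ {y} → y ∈ map f xs → y ∈ ys
      to-ys y∈ with ∈-map⁻ f y∈
      ... | x , x∈ , refl = f∈ x∈

      from-ys : ∀ {y} → y ∈ ys → y ∈ map f xs
      from-ys y∈ = subst (_∈ map f xs) (fg y∈) (∈-map⁺ f (g∈ y∈))

  even≢odd : ∀ q m → q * + 2 ≢ m * + 2 + + 1
  even≢odd q m eq = twice≢1 ∣ q - m ∣ (trans (sym (ℤP.abs-* (q - m) (+ 2))) (cong ∣_∣ difference))
    where
      twice≢1 : ∀ n → n ℕ.* 2 ≢ 1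
      twice≢1 zero    ()
      twice≢1 (suc n) ()

      ring : ∀ q m → (q - m) * + 2 ≡ q * + 2 - (m * + 2 + + 1) + + 1
      ring = solve-∀

      difference : (q - m) * + 2 ≡ + 1
      difference = trans (ring q m) (trans (cong (λ t → t - (m * + 2 + + 1) + + 1) eq) (cancel (m * + 2 + + 1)))
        where
          cancel : ∀ t → t - t + + 1 ≡ + 1
          cancel = solve-∀

  parity : ∀ x → (∃[ q ] x ≡ q * + 2) ⊎ Odd x
  parity x with x ℤ.% + 2 | ℤ.a≡a%n+[a/n]*n x (+ 2) | ℤ.n%d<d x (+ 2)
  ... | 0           | eq | _ = inj₁ (x ℤ./ + 2 , trans eq (ℤP.+-identityˡ _))
  ... | 1           | eq | _ = inj₂ (x ℤ./ + 2 , trans eq (ℤP.+-comm (+ 1) (x ℤ./ + 2 * + 2)))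
  ... | suc (suc _) | _  | s≤s (s≤s ())

  isOdd-correct : ∀ x → T (isOdd x) ⇔ Odd x
  isOdd-correct x = mk⇔ sound complete
    where
      sound : T (isOdd x) → Odd x
      sound t with parity x
      ... | inj₂ odd = odd
      ... | inj₁ (q , refl) with trans (sym (ℕ.m*n%n≡0 ∣ q ∣ 2)) (trans (cong (ℕ._% 2) (sym (ℤP.abs-* q (+ 2)))) (toWitness t))
      ...   | ()

      complete : Odd x → T (isOdd x)
      complete (m , x≡) = fromWitness remainder
        where
          remainder : ∣ x ∣ ℕ.% 2 ≡ 1
          remainder with ∣ x ∣ ℕ.% 2 in r | ℕ.m%n<n ∣ x ∣ 2
          ... | 1           | _             = refl
          ... | suc (suc _) | s≤s (s≤s ())
          ... | 0           | _ with ∣ᵤ⇒∣ {+ 2} {x} (ℕ.m%n≡0⇒n∣m ∣ x ∣ 2 r)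
          ...   | divides q x≡q*2 = ⊥-elim (even≢odd q m (trans (sym x≡q*2) x≡))

  Solution : ℕ → ℕ → ℤ → Point → Set
  Solution a b N p = OddPair p × form a b p ≡ N

  isSol11-correct : ∀ a b N p → isSol11 a b N p ≡ true ⇔ Solution a b N p
  isSol11-correct a b N (x , y) = mk⇔ sound complete
    where
      onForm : Bool
      onForm = ⌊ form a b (x , y) ℤ.≟ N ⌋

      sound : isSol11 a b N (x , y) ≡ true → Solution a b N (x , y)
      sound h =
        let (odd-x , rest) = to (T-∧ {isOdd x} {isOdd y Bool.∧ onForm}) (from T-≡ h)
            (odd-y , on-form) = to (T-∧ {isOdd y} {onForm}) rest
        in (to (isOdd-correct x) odd-x , to (isOdd-correct y) odd-y) , toWitness on-form

      complete : Solution a b N (x , y) → isSol11 a b N (x , y) ≡ true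
      complete ((odd-x , odd-y) , eq) = to T-≡
        (from (T-∧ {isOdd x} {isOdd y Bool.∧ onForm})
          (from (isOdd-correct x) odd-x , from (T-∧ {isOdd y} {onForm}) (from (isOdd-correct y) odd-y , fromWitness eq)))

  form-abs : ∀ a b x y → form a b (x , y) ≡ + (a ℕ.* (∣ x ∣ ℕ.* ∣ x ∣) ℕ.+ b ℕ.* (∣ y ∣ ℕ.* ∣ y ∣))
  form-abs a b x y = begin
    + a * (x * x) + + b * (y * y)                                   ≡⟨ cong₂ (λ s t → + a * s + + b * t) (square x) (square y) ⟩
    + a * + (∣ x ∣ ℕ.* ∣ x ∣) + + b * + (∣ y ∣ ℕ.* ∣ y ∣)            ≡⟨ cong₂ _+_ (ℤP.pos-* a _) (ℤP.pos-* b _) ⟨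
    + (a ℕ.* (∣ x ∣ ℕ.* ∣ x ∣)) + + (b ℕ.* (∣ y ∣ ℕ.* ∣ y ∣))       ≡⟨ ℤP.pos-+ (a ℕ.* (∣ x ∣ ℕ.* ∣ x ∣)) _ ⟨
    + (a ℕ.* (∣ x ∣ ℕ.* ∣ x ∣) ℕ.+ b ℕ.* (∣ y ∣ ℕ.* ∣ y ∣))         ∎
    where
      open ≡-Reasoning
      square : ∀ x → x * x ≡ + (∣ x ∣ ℕ.* ∣ x ∣)
      square (+ m)     = sym (ℤP.pos-* m m)
      square -[1+ m ]  = refl

  coordinate-bound : ∀ a m n .{{_ : ℕ.NonZero a}} → m ≤ a ℕ.* (m ℕ.* m) ℕ.+ n
  coordinate-bound a zero    n = z≤n
  coordinate-bound a (suc m) n = ℕP.≤-trans (ℕP.m≤m*n (suc m) (suc m))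
    (ℕP.≤-trans (ℕP.m≤n*m (suc m ℕ.* suc m) a) (ℕP.m≤m+n _ n))

  range-complete : ∀ n x → ∣ x ∣ ≤ n → x ∈ range n
  range-complete n (+ m) m≤n = subst (_∈ range n) shifted (∈-map⁺ (λ k → + k - + n) (∈-upTo⁺ in-box))
    where
      in-box : n ℕ.+ m < suc (2 ℕ.* n)
      in-box = s≤s (subst (n ℕ.+ m ≤_) (cong (n ℕ.+_) (sym (ℕP.+-identityʳ n))) (ℕP.+-monoʳ-≤ n m≤n))
      ring : ∀ s t → s + t - s ≡ t
      ring = solve-∀
      shifted : + (n ℕ.+ m) - + n ≡ + m
      shifted = trans (cong (_- + n) (ℤP.pos-+ n m)) (ring (+ n) (+ m))
  range-complete n -[1+ m ] m<n = subst (_∈ range n) shifted (∈-map⁺ (λ k → + k - + n) (∈-upTo⁺ in-box))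
    where
      k : ℕ
      k = n ℕ.∸ suc m
      in-box : k < suc (2 ℕ.* n)
      in-box = s≤s (ℕP.≤-trans (ℕP.m∸n≤m n (suc m)) (ℕP.m≤m+n n _))
      ring : ∀ s t → s - (s + t) ≡ - t
      ring = solve-∀
      shifted : + k - + n ≡ -[1+ m ]
      shifted = trans (cong (λ t → + k - + t) (sym (ℕP.m∸n+n≡m m<n)))
                      (trans (cong (λ t → + k - t) (ℤP.pos-+ k (suc m))) (ring (+ k) (+ suc m)))

  range-unique : ∀ n → Unique (range n)
  range-unique n = Unique.map⁺ shift-injective (Unique.upTo⁺ _)
    where
      ring : ∀ i k → i - k + k ≡ i
      ring = solve-∀
      shift-injective : ∀ {i j} → + i - + n ≡ + j - + n → i ≡ j
      shift-injective {i} {j} eq = ℤP.+-injective (trans (sym (ring (+ i) (+ n))) (trans (cong (_+ + n) eq) (ring (+ j) (+ n))))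

  candidates-product : ∀ N → candidates N ≡ cartesianProduct (range ∣ N ∣) (range ∣ N ∣)
  candidates-product N = concat-map (range ∣ N ∣) (range ∣ N ∣)
    where
      concat-map : ∀ (xs ys : List ℤ) → concatMap (λ x → map (λ y → (x , y)) ys) xs ≡ cartesianProduct xs ys
      concat-map []       ys = refl
      concat-map (x ∷ xs) ys = cong (map (λ y → (x , y)) ys ++_) (concat-map xs ys)

  solutions : ℕ → ℕ → ℤ → List Point
  solutions a b N = filter (λ p → isSol11 a b N p Bool.≟ true) (candidates N)

  solutions-unique : ∀ a b N → Unique (solutions a b N)
  solutions-unique a b N = Unique.filter⁺ (λ p → isSol11 a b N p Bool.≟ true)
    (subst Unique (sym (candidates-product N)) (Unique.cartesianProduct⁺ (range-unique ∣ N ∣) (range-unique ∣ N ∣)))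

  ∈-solutions : ∀ a b N p .{{_ : ℕ.NonZero a}} .{{_ : ℕ.NonZero b}} → p ∈ solutions a b N ⇔ Solution a b N p
  ∈-solutions a b N (x , y) = mk⇔
    (λ p∈ → to (isSol11-correct a b N (x , y)) (proj₂ (∈-filter⁻ (λ p → isSol11 a b N p Bool.≟ true) {xs = candidates N} p∈)))
    (λ sol → ∈-filter⁺ (λ p → isSol11 a b N p Bool.≟ true) (in-box sol) (from (isSol11-correct a b N (x , y)) sol))
    where
      in-box : Solution a b N (x , y) → (x , y) ∈ candidates N
      in-box (_ , eq) = subst ((x , y) ∈_) (sym (candidates-product N))
        (∈-cartesianProduct⁺ (range-complete ∣ N ∣ x (subst (∣ x ∣ ≤_) value (coordinate-bound a ∣ x ∣ _)))
                             (range-complete ∣ N ∣ y (subst (∣ y ∣ ≤_) (trans (ℕP.+-comm (b ℕ.* (∣ y ∣ ℕ.* ∣ y ∣)) _) value) (coordinate-bound b ∣ y ∣ _))))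
        where
          value : a ℕ.* (∣ x ∣ ℕ.* ∣ x ∣) ℕ.+ b ℕ.* (∣ y ∣ ℕ.* ∣ y ∣) ≡ ∣ N ∣
          value = cong ∣_∣ (trans (sym (form-abs a b x y)) eq)

  count-bijection : ∀ a b N M .{{_ : ℕ.NonZero a}} .{{_ : ℕ.NonZero b}} (f g : Point → Point) →
    (∀ p → Solution a b N p → Solution a b M (f p)) → (∀ q → Solution a b M q → Solution a b N (g q)) →
    (∀ p → Solution a b N p → g (f p) ≡ p) → (∀ q → Solution a b M q → f (g q) ≡ q) →
    r₁₁ a b N ≡ r₁₁ a b M
  count-bijection a b N M f g f-sol g-sol gf fg =
    length-bijection (solutions-unique a b N) (solutions-unique a b M) f g
      (λ p∈ → from (∈-solutions a b M _) (f-sol _ (to (∈-solutions a b N _) p∈)))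
      (λ q∈ → from (∈-solutions a b N _) (g-sol _ (to (∈-solutions a b M _) q∈)))
      (λ p∈ → gf _ (to (∈-solutions a b N _) p∈))
      (λ q∈ → fg _ (to (∈-solutions a b M _) q∈))

  count-positive : ∀ a b N p .{{_ : ℕ.NonZero a}} .{{_ : ℕ.NonZero b}} → Solution a b N p → 0 < r₁₁ a b N
  count-positive a b N p sol = nonempty (from (∈-solutions a b N p) sol)
    where
      nonempty : ∀ {xs : List Point} → p ∈ xs → 0 < length xs
      nonempty (here _)  = s≤s z≤n
      nonempty (there _) = s≤s z≤n

  solution-of-positive : ∀ a b N .{{_ : ℕ.NonZero a}} .{{_ : ℕ.NonZero b}} → 0 < r₁₁ a b N → ∃[ p ] Solution a b N p
  solution-of-positive a b N positive with solutions a b N in eq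
  ... | p ∷ _ = p , to (∈-solutions a b N p) (subst (p ∈_) (sym eq) (here refl))

module Necessity where

  open Counting

  open import Data.Nat as ℕ using (ℕ; zero; suc; _+_; _*_; _%_; _≤_; _<_; z≤n; s≤s)
  import Data.Nat.Properties as ℕP
  import Data.Nat.DivMod as ℕ
  open import Data.Nat.Divisibility using (_∣_; divides; _∣?_; ∣⇒≤; ∣m+n∣m⇒∣n; ∣m∣n⇒∣m+n; n∣m*n; m∣m*n; ∣-refl)
  open import Data.Nat.Coprimality using (Coprime; coprime-divisor; coprime?)
  open import Data.Nat.Tactic.RingSolver using (solve-∀)
  open import Data.Integer as ℤ using (ℤ; +_; ∣_∣)
  import Data.Integer.Properties as ℤP
  open import Data.Integer.Divisibility as Unsigned using ()
  open import Data.Product using (∃-syntax; _×_; _,_)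
  open import Data.Sum using (_⊎_; inj₁; inj₂)
  import Data.Sum as Sum
  open import Data.Empty using (⊥; ⊥-elim)
  open import Function.Bundles using (Equivalence)
  open import Relation.Binary.PropositionalEquality
  open import Relation.Nullary using (Dec; yes; no)
  open import Relation.Nullary.Decidable using (toWitness; toWitnessFalse; fromWitness)

  open Equivalence using (to; from)

  Stable : ℕ → ℕ → Set
  Stable a b = (m : ℤ) → (+ 8) Unsigned.∣ m → r₁₁ a b m ≡ r₁₁ a b ((+ 4) ℤ.* m)

  record OddRep (a b n : ℕ) : Set where
    constructor oddRep
    field
      X Y   : ℕ
      X-odd : X % 2 ≡ 1
      Y-odd : Y % 2 ≡ 1
      value : a * (X * X) + b * (Y * Y) ≡ n

  rep⇒solution : ∀ a b n → (r : OddRep a b n) → Solution a b (+ n) (+ OddRep.X r , + OddRep.Y r)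
  rep⇒solution a b n (oddRep X Y X-odd Y-odd value) =
    (to (isOdd-correct (+ X)) (fromWitness X-odd) , to (isOdd-correct (+ Y)) (fromWitness Y-odd)) ,
    trans (form-abs a b (+ X) (+ Y)) (cong +_ value)

  solution⇒rep : ∀ a b n x y → Solution a b (+ n) (x , y) → OddRep a b n
  solution⇒rep a b n x y ((odd-x , odd-y) , eq) =
    oddRep ∣ x ∣ ∣ y ∣ (toWitness (from (isOdd-correct x) odd-x)) (toWitness (from (isOdd-correct y) odd-y))
           (ℤP.+-injective (trans (sym (form-abs a b x y)) eq))

  lift : ∀ a b n .{{_ : ℕ.NonZero a}} .{{_ : ℕ.NonZero b}} → Stable a b → 8 ∣ n → OddRep a b n → OddRep a b (4 * n)
  lift a b n stable 8∣n r = from-solution (solution-of-positive a b (+ 4 ℤ.* + n) positive)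
    where
      positive : 0 < r₁₁ a b (+ 4 ℤ.* + n)
      positive = subst (0 <_) (stable (+ n) 8∣n) (count-positive a b (+ n) _ (rep⇒solution a b n r))

      from-solution : ∃[ p ] Solution a b (+ 4 ℤ.* + n) p → OddRep a b (4 * n)
      from-solution ((x , y) , sol) =
        solution⇒rep a b (4 * n) x y (subst (λ N → Solution a b N (x , y)) (sym (ℤP.pos-* 4 n)) sol)

  odd-nonZero : ∀ n → n % 2 ≡ 1 → ℕ.NonZero n
  odd-nonZero (suc n) _ = _

  odd-positive : ∀ n → n % 2 ≡ 1 → 1 ≤ n
  odd-positive (suc n) _ = s≤s z≤n

  odd-step : ∀ m Y → m % 2 ≡ 1 → Y % 2 ≡ 1 → m ≤ Y → Y ≡ m ⊎ 2 + m ≤ Y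
  odd-step m Y m-odd Y-odd m≤Y with ℕP.m≤n⇒∃[o]m+o≡n m≤Y
  ... | zero        , refl = inj₁ (ℕP.+-identityʳ m)
  ... | 1           , refl with trans (sym Y-odd) (trans (ℕ.%-distribˡ-+ m 1 2) (cong (λ r → (r + 1) % 2) m-odd))
  ...   | ()
  odd-step m Y m-odd Y-odd m≤Y | suc (suc d) , refl = inj₂ (subst (2 + m ≤_) (ring m d) (ℕP.m≤m+n (2 + m) d))
    where
      ring : ∀ m d → 2 + m + d ≡ m + suc (suc d)
      ring = solve-∀

  odd≤7 : ∀ X → X % 2 ≡ 1 → X ≤ 7 → X ≡ 1 ⊎ X ≡ 3 ⊎ X ≡ 5 ⊎ X ≡ 7
  odd≤7 1 _ _ = inj₁ refl
  odd≤7 3 _ _ = inj₂ (inj₁ refl)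
  odd≤7 5 _ _ = inj₂ (inj₂ (inj₁ refl))
  odd≤7 7 _ _ = inj₂ (inj₂ (inj₂ refl))
  odd≤7 0 () _
  odd≤7 2 () _
  odd≤7 4 () _
  odd≤7 6 () _
  odd≤7 (suc (suc (suc (suc (suc (suc (suc (suc _)))))))) _ (s≤s (s≤s (s≤s (s≤s (s≤s (s≤s (s≤s ())))))))

  -- Two squares differing by 32 are 7² and 9² (or 2² and 6²): the smaller root is at most 7.
  square-gap : ∀ X Z → Z * Z ≡ X * X + 32 → X ≤ 7
  square-gap X Z eq with X ℕP.<? Z
  ... | no X≮Z = ⊥-elim (ℕP.<-irrefl eq (ℕP.≤-<-trans (ℕP.*-mono-≤ Z≤X Z≤X) (ℕP.m<m+n (X * X) {32} (s≤s z≤n))))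
    where Z≤X = ℕP.≮⇒≥ X≮Z
  ... | yes X<Z with ℕP.m≤n⇒∃[o]m+o≡n X<Z
  ...   | zero , refl = ⊥-elim (odd≢even (ℕP.+-cancelˡ-≡ (X * X) _ _ (trans (sym (ring₁ X)) eq)))
    where
      ring₁ : ∀ X → (suc X + 0) * (suc X + 0) ≡ X * X + (X * 2 + 1)
      ring₁ = solve-∀
      odd≢even : X * 2 + 1 ≢ 32
      odd≢even e with trans (sym (ℕ.[m+kn]%n≡m%n 1 X 2)) (trans (cong (_% 2) (ℕP.+-comm 1 (X * 2))) (cong (_% 2) e))
      ... | ()
  ...   | suc d , refl = ℕP.*-cancelˡ-≤ 4 (ℕP.+-cancelʳ-≤ 4 (4 * X) 28
            (ℕP.≤-trans (ℕP.m≤m+n (4 * X + 4) (2 * X * d + 4 * d + d * d))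
                        (ℕP.≤-reflexive (ℕP.+-cancelˡ-≡ (X * X) _ _ (trans (sym (ring₂ X d)) eq)))))
    where
      ring₂ : ∀ X d → (suc X + suc d) * (suc X + suc d) ≡ X * X + ((4 * X + 4) + (2 * X * d + 4 * d + d * d))
      ring₂ = solve-∀

  large-Y : ∀ a b n {X Y} c → c ≤ Y → a * (X * X) + b * (Y * Y) ≡ n → n < b * (c * c) → ⊥
  large-Y a b n {X} {Y} c c≤Y eq n<bc² = ℕP.<-irrefl refl (ℕP.<-≤-trans n<bc² (begin
    b * (c * c)                  ≤⟨ ℕP.*-monoʳ-≤ b (ℕP.*-mono-≤ c≤Y c≤Y) ⟩
    b * (Y * Y)                  ≤⟨ ℕP.m≤n+m (b * (Y * Y)) (a * (X * X)) ⟩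
    a * (X * X) + b * (Y * Y)    ≡⟨ eq ⟩
    n                            ∎))
    where open ℕP.≤-Reasoning

  exceeds : ∀ n m k → m ≡ suc n + k → n < m
  exceeds n m k eq = subst (n <_) (sym eq) (ℕP.m≤m+n (suc n) k)

  a∣3 : ∀ a → a ∣ 3 → a ≡ 1 ⊎ a ≡ 3
  a∣3 0 0∣3 = ⊥-elim (toWitnessFalse {a? = 0 ∣? 3} _ 0∣3)
  a∣3 1 _   = inj₁ refl
  a∣3 2 2∣3 = ⊥-elim (toWitnessFalse {a? = 2 ∣? 3} _ 2∣3)
  a∣3 3 _   = inj₂ refl
  a∣3 (suc (suc (suc (suc _)))) d with ∣⇒≤ d
  ... | s≤s (s≤s (s≤s ()))

  three∤ : ∀ b k L → Coprime 3 b → Coprime 3 k → 3 * L ≡ 12 + k * b → ⊥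
  three∤ b k L 3⊥b 3⊥k eq = 3≰1 (∣⇒≤ 3∣1)
    where
      3≰1 : 3 ≤ 1 → ⊥
      3≰1 (s≤s ())
      3∣kb : 3 ∣ k * b
      3∣kb = ∣m+n∣m⇒∣n (subst (3 ∣_) eq (m∣m*n L)) (divides 4 refl)
      3∣1 : 3 ∣ 1
      3∣1 = coprime-divisor 3⊥b (subst (3 ∣_) (sym (ℕP.*-identityʳ b)) (coprime-divisor 3⊥k 3∣kb))

  b-from-square₁ : ∀ X b → X % 2 ≡ 1 → X ≤ 7 → X * X ≡ 4 + 3 * b → b ≡ 7 ⊎ b ≡ 15
  b-from-square₁ X b X-odd X≤7 eq with odd≤7 X X-odd X≤7
  ... | inj₁ refl                   with eq
  ...   | ()
  b-from-square₁ X b X-odd X≤7 eq | inj₂ (inj₁ refl) =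
    ⊥-elim (toWitnessFalse {a? = 3 ∣? 5} _ (divides b (trans (ℕP.+-cancelˡ-≡ 4 5 (3 * b) eq) (ℕP.*-comm 3 b))))
  b-from-square₁ X b X-odd X≤7 eq | inj₂ (inj₂ (inj₁ refl)) = inj₁ (sym (ℕP.*-cancelˡ-≡ 7 b 3 (ℕP.+-cancelˡ-≡ 4 21 (3 * b) eq)))
  b-from-square₁ X b X-odd X≤7 eq | inj₂ (inj₂ (inj₂ refl)) = inj₂ (sym (ℕP.*-cancelˡ-≡ 15 b 3 (ℕP.+-cancelˡ-≡ 4 45 (3 * b) eq)))

  b-from-square₃ : ∀ X b → X % 2 ≡ 1 → X ≤ 7 → X * X ≡ 4 + 9 * b → b ≡ 5
  b-from-square₃ X b X-odd X≤7 eq with odd≤7 X X-odd X≤7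
  ... | inj₁ refl                   with eq
  ...   | ()
  b-from-square₃ X b X-odd X≤7 eq | inj₂ (inj₁ refl) =
    ⊥-elim (toWitnessFalse {a? = 9 ∣? 5} _ (divides b (trans (ℕP.+-cancelˡ-≡ 4 5 (9 * b) eq) (ℕP.*-comm 9 b))))
  b-from-square₃ X b X-odd X≤7 eq | inj₂ (inj₂ (inj₁ refl)) =
    ⊥-elim (toWitnessFalse {a? = 9 ∣? 21} _ (divides b (trans (ℕP.+-cancelˡ-≡ 4 21 (9 * b) eq) (ℕP.*-comm 9 b))))
  b-from-square₃ X b X-odd X≤7 eq | inj₂ (inj₂ (inj₂ refl)) = sym (ℕP.*-cancelˡ-≡ 5 b 9 (ℕP.+-cancelˡ-≡ 4 45 (9 * b) eq))

  -- Lifting a + b = a·1² + b·1² forces Y = 1, i.e. a X² = 4a + 3b.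
  first-lift : ∀ a b → a < b → (r : OddRep a b (4 * (a + b))) → a * (OddRep.X r * OddRep.X r) ≡ 4 * a + 3 * b
  first-lift a b a<b (oddRep X Y X-odd Y-odd value) = by-Y (odd-step 1 Y refl Y-odd (odd-positive Y Y-odd))
    where
      by-Y : Y ≡ 1 ⊎ 3 ≤ Y → a * (X * X) ≡ 4 * a + 3 * b
      by-Y (inj₁ refl) = ℕP.+-cancelʳ-≡ b _ _ (trans (cong (λ t → a * (X * X) + t) (ring₁ b)) (trans value (ring₂ a b)))
        where
          ring₁ : ∀ b → b ≡ b * (1 * 1)
          ring₁ = solve-∀
          ring₂ : ∀ a b → 4 * (a + b) ≡ 4 * a + 3 * b + b
          ring₂ = solve-∀
      by-Y (inj₂ 3≤Y) = ⊥-elim (large-Y a b _ {X} 3 3≤Y value (too-large (ℕP.m≤n⇒∃[o]m+o≡n a<b)))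
        where
          ring : ∀ a t → (suc a + t) * (3 * 3) ≡ suc (4 * (a + (suc a + t))) + (a + 4 + 5 * t)
          ring = solve-∀
          too-large : (∃[ t ] suc a + t ≡ b) → 4 * (a + b) < b * (3 * 3)
          too-large (t , refl) = exceeds _ _ (a + 4 + 5 * t) (ring a t)

  Exceptional : ℕ → ℕ → Set
  Exceptional a b = (a ≡ 3 × b ≡ 5) ⊎ (a ≡ 1 × b ≡ 7) ⊎ (a ≡ 1 × b ≡ 15)

  -- a = 1: lifting 9 + b = 1·3² + b·1² leaves only b = 7 and b = 15.
  case-1 : ∀ a b .{{_ : ℕ.NonZero b}} → a ≡ 1 → 1 < b → 8 ∣ 1 + b → Stable a b →
           ∀ X → X % 2 ≡ 1 → a * (X * X) ≡ 4 * a + 3 * b → Exceptional a b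
  case-1 .1 b refl 1<b 8∣1+b stable X X-odd aX² =
    inj₂ (analyse (lift 1 b (9 + b) stable (∣m∣n⇒∣m+n (∣-refl {8}) 8∣1+b) (oddRep 3 1 refl refl (seed b))))
    where
      seed : ∀ b → 1 * (3 * 3) + b * (1 * 1) ≡ 9 + b
      seed = solve-∀

      X² : X * X ≡ 4 + 3 * b
      X² = trans (sym (ℕP.*-identityˡ (X * X))) aX²

      analyse : OddRep 1 b (4 * (9 + b)) → (1 ≡ 1 × b ≡ 7) ⊎ (1 ≡ 1 × b ≡ 15)
      analyse (oddRep X′ Y′ X′-odd Y′-odd value) = by-Y′ (odd-step 1 Y′ refl Y′-odd (odd-positive Y′ Y′-odd))
        where
          by-Y′ : Y′ ≡ 1 ⊎ 3 ≤ Y′ → (1 ≡ 1 × b ≡ 7) ⊎ (1 ≡ 1 × b ≡ 15)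
          by-Y′ (inj₁ refl) = Sum.map (refl ,_) (refl ,_) (b-from-square₁ X b X-odd (square-gap X X′ gap) X²)
            where
              ring₁ : ∀ X′ b → 1 * (X′ * X′) + b * (1 * 1) ≡ X′ * X′ + b
              ring₁ = solve-∀
              ring₂ : ∀ b → 4 * (9 + b) ≡ (4 + 3 * b) + 32 + b
              ring₂ = solve-∀
              gap : X′ * X′ ≡ X * X + 32
              gap = ℕP.+-cancelʳ-≡ b _ _ (trans (sym (ring₁ X′ b)) (trans value (trans (ring₂ b) (cong (λ s → s + 32 + b) (sym X²)))))
          by-Y′ (inj₂ 3≤Y′) = by-Y″ (odd-step 3 Y′ refl Y′-odd 3≤Y′)
            where
              by-Y″ : Y′ ≡ 3 ⊎ 5 ≤ Y′ → (1 ≡ 1 × b ≡ 7) ⊎ (1 ≡ 1 × b ≡ 15)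
              by-Y″ (inj₁ refl) = inj₁ (refl , b≡7 (b ℕP.≤? 7))
                where
                  ring : ∀ t → (8 + t) * (3 * 3) ≡ suc (4 * (9 + (8 + t))) + (3 + 5 * t)
                  ring = solve-∀
                  too-large : (∃[ t ] 8 + t ≡ b) → 4 * (9 + b) < b * (3 * 3)
                  too-large (t , refl) = exceeds _ _ (3 + 5 * t) (ring t)
                  b≡7 : Dec (b ≤ 7) → b ≡ 7
                  b≡7 (yes b≤7) = ℕP.≤-antisym b≤7 (ℕP.≤-pred (∣⇒≤ 8∣1+b))
                  b≡7 (no b≰7)  = ⊥-elim (large-Y 1 b _ {X′} 3 ℕP.≤-refl value (too-large (ℕP.m≤n⇒∃[o]m+o≡n (ℕP.≰⇒> b≰7))))
              by-Y″ (inj₂ 5≤Y′) = ⊥-elim (large-Y 1 b _ {X′} 5 5≤Y′ value (too-large (ℕP.m≤n⇒∃[o]m+o≡n 1<b)))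
                where
                  ring : ∀ t → (2 + t) * (5 * 5) ≡ suc (4 * (9 + (2 + t))) + (5 + 21 * t)
                  ring = solve-∀
                  too-large : (∃[ t ] 2 + t ≡ b) → 4 * (9 + b) < b * (5 * 5)
                  too-large (t , refl) = exceeds _ _ (5 + 21 * t) (ring t)

  three-obstruction : ∀ b k L Y → Coprime 3 b → Coprime 3 k → k + Y * Y ≡ 36 → 3 * L + b * (Y * Y) ≡ 4 * (3 + 9 * b) → ⊥
  three-obstruction b k L Y 3⊥b 3⊥k k+Y²≡36 value =
    three∤ b k L 3⊥b 3⊥k (ℕP.+-cancelʳ-≡ (b * (Y * Y)) _ _ (trans value (begin
      4 * (3 + 9 * b)            ≡⟨ ring₁ b ⟩
      12 + 36 * b                ≡⟨ cong (λ s → 12 + s * b) k+Y²≡36 ⟨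
      12 + (k + Y * Y) * b       ≡⟨ ring₂ k (Y * Y) b ⟩
      12 + k * b + b * (Y * Y)   ∎)))
    where
      open ≡-Reasoning
      ring₁ : ∀ b → 4 * (3 + 9 * b) ≡ 12 + 36 * b
      ring₁ = solve-∀
      ring₂ : ∀ k s b → 12 + (k + s) * b ≡ 12 + k * b + b * s
      ring₂ = solve-∀

  -- a = 3: lifting 3 + 9b = 3·1² + b·3² leaves only b = 5.
  case-3 : ∀ a b .{{_ : ℕ.NonZero b}} → a ≡ 3 → 3 < b → Coprime a b → 8 ∣ 3 + b → Stable a b →
           ∀ X → a * (X * X) ≡ 4 * a + 3 * b → Exceptional a b
  case-3 .3 b refl 3<b 3⊥b 8∣3+b stable X aX² = inj₁ (refl , analyse (lift 3 b (3 + 9 * b) stable 8∣n (oddRep 1 3 refl refl (seed b))))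
    where
      seed : ∀ b → 3 * (1 * 1) + b * (3 * 3) ≡ 3 + 9 * b
      seed = solve-∀

      8∣n : 8 ∣ 3 + 9 * b
      8∣n = subst (8 ∣_) (ring b) (∣m∣n⇒∣m+n 8∣3+b (n∣m*n b))
        where
          ring : ∀ b → 3 + b + b * 8 ≡ 3 + 9 * b
          ring = solve-∀

      X² : X * X ≡ 4 + b
      X² = ℕP.*-cancelˡ-≡ (X * X) (4 + b) 3 (trans aX² (ring b))
        where
          ring : ∀ b → 4 * 3 + 3 * b ≡ 3 * (4 + b)
          ring = solve-∀

      analyse : OddRep 3 b (4 * (3 + 9 * b)) → b ≡ 5
      analyse (oddRep X′ Y′ X′-odd Y′-odd value) = by-Y′ (odd-step 1 Y′ refl Y′-odd (odd-positive Y′ Y′-odd))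
        where
          by-Y′ : Y′ ≡ 1 ⊎ 3 ≤ Y′ → b ≡ 5
          by-Y′ (inj₁ refl) = ⊥-elim (three-obstruction b 35 (X′ * X′) 1 3⊥b (toWitness {a? = coprime? 3 35} _) refl value)
          by-Y′ (inj₂ 3≤Y′) = by-Y″ (odd-step 3 Y′ refl Y′-odd 3≤Y′)
            where
              by-Y″ : Y′ ≡ 3 ⊎ 5 ≤ Y′ → b ≡ 5
              -- Y′ = 3 makes (3X)² - X′² = 32.
              by-Y″ (inj₁ refl) = b-from-square₃ X′ b X′-odd (square-gap X′ (3 * X) gap) X′²
                where
                  ring₁ : ∀ b → 4 * (3 + 9 * b) ≡ 3 * (4 + 9 * b) + b * (3 * 3)
                  ring₁ = solve-∀
                  X′² : X′ * X′ ≡ 4 + 9 * b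
                  X′² = ℕP.*-cancelˡ-≡ (X′ * X′) (4 + 9 * b) 3 (ℕP.+-cancelʳ-≡ (b * (3 * 3)) _ _ (trans value (ring₁ b)))
                  ring₂ : ∀ X b → X * X ≡ 4 + b → (3 * X) * (3 * X) ≡ (4 + 9 * b) + 32
                  ring₂ X b eq = trans (ring₃ X) (trans (cong (9 *_) eq) (ring₄ b))
                    where
                      ring₃ : ∀ X → (3 * X) * (3 * X) ≡ 9 * (X * X)
                      ring₃ = solve-∀
                      ring₄ : ∀ b → 9 * (4 + b) ≡ (4 + 9 * b) + 32
                      ring₄ = solve-∀
                  gap : (3 * X) * (3 * X) ≡ X′ * X′ + 32
                  gap = trans (ring₂ X b X²) (cong (_+ 32) (sym X′²))
              by-Y″ (inj₂ 5≤Y′) = by-Y‴ (odd-step 5 Y′ refl Y′-odd 5≤Y′)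
                where
                  by-Y‴ : Y′ ≡ 5 ⊎ 7 ≤ Y′ → b ≡ 5
                  by-Y‴ (inj₁ refl) = ⊥-elim (three-obstruction b 11 (X′ * X′) 5 3⊥b (toWitness {a? = coprime? 3 11} _) refl value)
                  by-Y‴ (inj₂ 7≤Y′) = ⊥-elim (large-Y 3 b _ {X′} 7 7≤Y′ value (too-large (ℕP.m≤n⇒∃[o]m+o≡n 3<b)))
                    where
                      ring : ∀ t → (4 + t) * (7 * 7) ≡ suc (4 * (3 + 9 * (4 + t))) + (39 + 13 * t)
                      ring = solve-∀
                      too-large : (∃[ t ] 4 + t ≡ b) → 4 * (3 + 9 * b) < b * (7 * 7)
                      too-large (t , refl) = exceeds _ _ (39 + 13 * t) (ring t)

  necessity : ∀ a b → a % 2 ≡ 1 → b % 2 ≡ 1 → a < b → Coprime a b → 8 ∣ a + b → Stable a b → Exceptional a b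
  necessity a b a-odd b-odd a<b a⊥b 8∣a+b stable = by-a (a∣3 a (coprime-divisor a⊥b a∣b*3))
    where
      instance
        a≢0 : ℕ.NonZero a
        a≢0 = odd-nonZero a a-odd
        b≢0 : ℕ.NonZero b
        b≢0 = odd-nonZero b b-odd

      seed : ∀ a b → a * (1 * 1) + b * (1 * 1) ≡ a + b
      seed = solve-∀

      r : OddRep a b (4 * (a + b))
      r = lift a b (a + b) stable 8∣a+b (oddRep 1 1 refl refl (seed a b))

      X : ℕ
      X = OddRep.X r

      aX² : a * (X * X) ≡ 4 * a + 3 * b
      aX² = first-lift a b a<b r

      a∣b*3 : a ∣ b * 3
      a∣b*3 = subst (a ∣_) (ℕP.*-comm 3 b) (∣m+n∣m⇒∣n (subst (a ∣_) aX² (m∣m*n (X * X))) (n∣m*n 4))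

      by-a : a ≡ 1 ⊎ a ≡ 3 → Exceptional a b
      by-a (inj₁ a≡1) = case-1 a b a≡1 (subst (_< b) a≡1 a<b) (subst (λ a → 8 ∣ a + b) a≡1 8∣a+b) stable X (OddRep.X-odd r) aX²
      by-a (inj₂ a≡3) = case-3 a b a≡3 (subst (_< b) a≡3 a<b) a⊥b (subst (λ a → 8 ∣ a + b) a≡3 8∣a+b) stable X aX²

module Sufficiency where

  open ResidueTests
  open Points
  open Composition
  open Counting

  open import Data.Bool using (true; false; T)
  open import Data.Nat as ℕ using (ℕ)
  open import Data.Integer using (ℤ; +_; _+_; _*_)
  import Data.Integer.Properties as ℤP
  open import Data.Integer.Divisibility as Unsigned using ()
  open import Data.Integer.Divisibility.Signed using (_∣_; divides; ∣ᵤ⇒∣)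
  open import Data.Integer.Tactic.RingSolver using (solve-∀)
  open import Data.Product using (_,_; proj₂)
  open import Data.Unit using (tt)
  open import Function.Bundles using (Equivalence)
  open import Relation.Binary.PropositionalEquality

  module ViaTwists (a b : ℕ) .{{_ : ℕ.NonZero a}} .{{_ : ℕ.NonZero b}} (c : ℤ) (c²+ab≡16 : c * c + + a * + b ≡ + 16)
    (up-check   : T (holdsOnResidues (Twists.admissible a b c c²+ab≡16 ⊤ᵗ (+ 8) true)))
    (down-check : T (holdsOnResidues (Twists.admissible a b c c²+ab≡16 (quadratic (+ a) (+ b)) (+ 2) false))) where

    open Twists a b c c²+ab≡16
    module Up   = RoundTrip 8 2 refl ⊤ᵗ true (holdsEverywhere (admissible ⊤ᵗ (+ 8) true) up-check)
    module Down = RoundTrip 2 8 refl (quadratic (+ a) (+ b)) false (holdsEverywhere (admissible (quadratic (+ a) (+ b)) (+ 2) false) down-check)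

    up down : Point → Point
    up   = step 8 2 true
    down = step 2 8 false

    divisible-value : ∀ N → + 8 ∣ N → ∀ x y → form a b (x , y) ≡ + 4 * N → T (⟦ quadratic (+ a) (+ b) ⟧ (x , y))
    divisible-value N (divides q refl) x y eq =
      Equivalence.from (div32-correct (form a b (x , y))) (divides q (trans eq (ring q)))
      where
        ring : ∀ q → + 4 * (q * + 8) ≡ q * + 32
        ring = solve-∀

    up-solution : ∀ N p → Solution a b N p → Solution a b (+ 4 * N) (up p)
    up-solution N p (p-odd , refl) =
      let (up-odd , value , _) = Up.round-trip p p-odd tt
      in up-odd , ℤP.*-cancelˡ-≡ (+ 4) _ _ (trans value (ring (form a b p)))
      where
        ring : ∀ n → + 16 * n ≡ + 4 * (+ 4 * n)
        ring = solve-∀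

    down-up : ∀ N p → Solution a b N p → down (up p) ≡ p
    down-up N p (p-odd , _) = proj₂ (proj₂ (Up.round-trip p p-odd tt))

    down-solution : ∀ N → + 8 ∣ N → ∀ q → Solution a b (+ 4 * N) q → Solution a b N (down q)
    down-solution N 8∣N (x , y) (q-odd , eq) =
      let (down-odd , value , _) = Down.round-trip (x , y) q-odd (divisible-value N 8∣N x y eq)
      in down-odd , ℤP.*-cancelˡ-≡ (+ 64) _ _ (trans value (trans (cong (+ 16 *_) eq) (ring N)))
      where
        ring : ∀ n → + 16 * (+ 4 * n) ≡ + 64 * n
        ring = solve-∀

    up-down : ∀ N → + 8 ∣ N → ∀ q → Solution a b (+ 4 * N) q → up (down q) ≡ q
    up-down N 8∣N (x , y) (q-odd , eq) = proj₂ (proj₂ (Down.round-trip (x , y) q-odd (divisible-value N 8∣N x y eq)))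

    count-stable : ∀ N → + 8 Unsigned.∣ N → r₁₁ a b N ≡ r₁₁ a b (+ 4 * N)
    count-stable N 8∣N = count-bijection a b N (+ 4 * N) up down
      (up-solution N) (down-solution N (∣ᵤ⇒∣ 8∣N)) (down-up N) (up-down N (∣ᵤ⇒∣ 8∣N))

  -- The exceptional pairs, with c = 1, 3, 1; the residue conditions are
  -- verified by evaluation.
  stable-3-5 : ∀ m → + 8 Unsigned.∣ m → r₁₁ 3 5 m ≡ r₁₁ 3 5 (+ 4 * m)
  stable-3-5 = ViaTwists.count-stable 3 5 (+ 1) refl _ _

  stable-1-7 : ∀ m → + 8 Unsigned.∣ m → r₁₁ 1 7 m ≡ r₁₁ 1 7 (+ 4 * m)
  stable-1-7 = ViaTwists.count-stable 1 7 (+ 3) refl _ _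

  stable-1-15 : ∀ m → + 8 Unsigned.∣ m → r₁₁ 1 15 m ≡ r₁₁ 1 15 (+ 4 * m)
  stable-1-15 = ViaTwists.count-stable 1 15 (+ 1) refl _ _

open import Data.Nat using (ℕ; _<_; _+_; _%_)
open import Data.Nat.Divisibility using (_∣_)
open import Data.Nat.Coprimality using (Coprime)
open import Data.Integer as ℤ using (ℤ; +_)
open import Data.Integer.Divisibility as ℤD using ()
open import Data.Product using (_×_; _,_)
open import Data.Sum using (_⊎_; inj₁; inj₂)
open import Function.Bundles using (_⇔_; mk⇔)
open import Relation.Binary.PropositionalEquality using (_≡_; refl)
open Necessity using (Stable; Exceptional; necessity)
open Sufficiency using (stable-3-5; stable-1-7; stable-1-15)

lemma3p2 : (a b : ℕ) → a % 2 ≡ 1 → b % 2 ≡ 1 → a < b → Coprime a b → 8 ∣ (a + b) →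
    (((m : ℤ) → (+ 8) ℤD.∣ m → r₁₁ a b m ≡ r₁₁ a b ((+ 4) ℤ.* m))
      ⇔ ((a ≡ 3 × b ≡ 5) ⊎ (a ≡ 1 × b ≡ 7) ⊎ (a ≡ 1 × b ≡ 15)))
lemma3p2 a b a-odd b-odd a<b a⊥b 8∣a+b = mk⇔ (necessity a b a-odd b-odd a<b a⊥b 8∣a+b) sufficiency
  where
    sufficiency : Exceptional a b → Stable a b
    sufficiency (inj₁ (refl , refl))         = stable-3-5
    sufficiency (inj₂ (inj₁ (refl , refl))) = stable-1-7
    sufficiency (inj₂ (inj₂ (refl , refl))) = stable-1-15
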